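{- For all integers $k \ge 2$, $m(k) \le (3/2)\lfloor \log_2 k \rfloor + 1$.
   Context: A topology on a finite set $X$ is a collection of subsets of $X$ containing $\emptyset$ and $X$ and closed under unions and finite intersections; its members are open sets. For an integer $k \ge 2$, $m(k)$ is the smallest positive integer $n$ such that there exists a topology on an $n$-point set having exactly $k$ open sets. -}

module Defs where

open import Data.Nat using (ℕ; _≤_; _+_; _*_)
open import Data.Nat.Logarithm using (⌊log₂_⌋)
open import Data.Fin.Subset using (Subset; ⊥; ⊤; _∪_; _∩_)
open import Data.List using (List; length)
open import Data.List.Membership.Propositional using (_∈_)
open import Data.List.Relation.Unary.Unique.Propositional using (Unique)
open import Data.Product using (Σ; ∃; _×_)
open import Relation.Binary.PropositionalEquality using (_≡_)

-- A family of subsets of the n-point set Fin n, given as a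
-- duplicate-free list (so its length is the number of members),
-- is a topology if it contains ∅ and X and is closed under
-- (binary, hence all finite = all) unions and finite intersections.
record IsTopology {n : ℕ} (𝒯 : List (Subset n)) : Set where
  field
    distinct   : Unique 𝒯
    empty-open : ⊥ ∈ 𝒯
    full-open  : ⊤ ∈ 𝒯
    ∪-closed   : ∀ {U V} → U ∈ 𝒯 → V ∈ 𝒯 → (U ∪ V) ∈ 𝒯
    ∩-closed   : ∀ {U V} → U ∈ 𝒯 → V ∈ 𝒯 → (U ∩ V) ∈ 𝒯

HasTopologyWithOpens : ℕ → ℕ → Set
HasTopologyWithOpens n k =
  Σ (List (Subset n)) λ 𝒯 → IsTopology 𝒯 × length 𝒯 ≡ k

-- Adjoining one point p to a space whose topology 𝒯 has k opens can be done
-- in three ways: p isolated (opens U and U ∪ {p}, 2k of them), p in every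
-- nonempty open (k + 1), or the opens containing p are the F ∪ {p} for F in
-- a filter Φ of the lattice 𝒯 (k + |Φ|). If the space carries a
-- three-element filter, so does each of its extensions, and two doublings
-- combined with at most one further step turn k opens on n points into
-- 4k + r opens (0 ≤ r ≤ 3) on at most n + 3 points. As ⌊log₂⌋ grows by 2
-- along the way, the bound 2n ≤ 3⌊log₂ k⌋ + 2 propagates by strong
-- induction from the cases 3 ≤ k < 12.
module Submission where

open import Data.Bool using (false; true)
open import Data.Fin.Subset using (Subset; ⊥; ⊤; _∪_; _∩_)
open import Data.Fin.Subset.Properties using (∪-comm; ∩-comm; ∪-identityˡ; ∩-zeroˡ)
open import Data.List using (List; []; _∷_; [_]; length; map; _++_)
open import Data.List.Properties using (length-++; length-map)
open import Data.List.Membership.Propositional using (_∈_)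
open import Data.List.Membership.Propositional.Properties
  using (∈-map⁺; ∈-map⁻; ∈-++⁺ˡ; ∈-++⁺ʳ; ∈-++⁻)
open import Data.List.Relation.Unary.Any using (here)
open import Data.List.Relation.Unary.All using ([])
open import Data.List.Relation.Unary.AllPairs using ([]; _∷_)
open import Data.List.Relation.Unary.Unique.Propositional using (Unique)
import Data.List.Relation.Unary.Unique.Propositional.Properties as Unique
open import Data.Nat using (ℕ; suc; _≤_; _<_; _+_; _*_; z≤n; s≤s; _<?_; _≤?_; >-nonZero)
open import Data.Nat.DivMod using (_/_; _%_; m≡m%n+[m/n]*n; m%n<n; m/n<m; /-monoˡ-≤)
open import Data.Nat.Induction using (<-rec)
open import Data.Nat.Logarithm using (⌊log₂_⌋; ⌊log₂⌋-mono-≤; ⌊log₂[2*b]⌋≡1+⌊log₂b⌋)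
open import Data.Nat.Properties
  using ( ≤-trans; ≤-reflexive; m≤n+m; n≤1+n; m+n≮m; ≮⇒≥; +-assoc; *-distribˡ-+
        ; +-monoˡ-≤; +-monoʳ-≤; *-monoʳ-≤; module ≤-Reasoning )
open import Data.Nat.Tactic.RingSolver using (solve-∀)
open import Data.Product using (∃; _×_; _,_)
open import Data.Sum using (inj₁; inj₂)
open import Data.Vec using ([]; _∷_)
open import Data.Vec.Properties using (∷-injectiveʳ)
open import Relation.Binary.PropositionalEquality using (_≡_; refl; sym; trans; cong; cong₂; subst)
open import Relation.Nullary using (¬_; yes; no; contradiction)
open import Relation.Nullary.Decidable using (True; toWitness)

open import Defs

module _ {n : ℕ} where

  Absorbs : List (Subset n) → List (Subset n) → Set
  Absorbs A B = ∀ {U V} → U ∈ A → V ∈ B → (U ∪ V) ∈ B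

  ⊥-absorbs : ∀ {B} → Absorbs [ ⊥ ] B
  ⊥-absorbs {B} {V = V} (here refl) V∈B = subst (_∈ B) (sym (∪-identityˡ V)) V∈B

  ⊥-∩-closed : ∀ {B : List (Subset n)} {U V} → U ∈ [ ⊥ ] → V ∈ B → (U ∩ V) ∈ [ ⊥ ]
  ⊥-∩-closed {V = V} (here refl) _ = here (∩-zeroˡ V)

  -- The new point comes first: the opens avoiding it are A, those containing it are B
  -- (both given by their traces on the old points).
  extend : List (Subset n) → List (Subset n) → List (Subset (suc n))
  extend A B = map (false ∷_) A ++ map (true ∷_) B

  module _ {A B : List (Subset n)} where

    ∈-extend⁺ˡ : ∀ {U} → U ∈ A → (false ∷ U) ∈ extend A B
    ∈-extend⁺ˡ U∈A = ∈-++⁺ˡ (∈-map⁺ (false ∷_) U∈A)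

    ∈-extend⁺ʳ : ∀ {U} → U ∈ B → (true ∷ U) ∈ extend A B
    ∈-extend⁺ʳ U∈B = ∈-++⁺ʳ (map (false ∷_) A) (∈-map⁺ (true ∷_) U∈B)

    ∈-extend⁻ˡ : ∀ {U} → (false ∷ U) ∈ extend A B → U ∈ A
    ∈-extend⁻ˡ p with ∈-++⁻ (map (false ∷_) A) p
    ... | inj₁ q with ∈-map⁻ (false ∷_) q
    ...   | _ , U∈A , refl = U∈A
    ∈-extend⁻ˡ p | inj₂ q with ∈-map⁻ (true ∷_) q
    ...   | _ , _ , ()

    ∈-extend⁻ʳ : ∀ {U} → (true ∷ U) ∈ extend A B → U ∈ B
    ∈-extend⁻ʳ p with ∈-++⁻ (map (false ∷_) A) p
    ... | inj₂ q with ∈-map⁻ (true ∷_) q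
    ...   | _ , U∈B , refl = U∈B
    ∈-extend⁻ʳ p | inj₁ q with ∈-map⁻ (false ∷_) q
    ...   | _ , _ , ()

    length-extend : length (extend A B) ≡ length A + length B
    length-extend = trans (length-++ (map (false ∷_) A))
                          (cong₂ _+_ (length-map (false ∷_) A) (length-map (true ∷_) B))

  record IsExtensionPair (A B : List (Subset n)) : Set where
    field
      distinctˡ : Unique A
      distinctʳ : Unique B
      ⊥∈ˡ       : ⊥ ∈ A
      ⊤∈ʳ       : ⊤ ∈ B
      ∪-closedˡ : ∀ {U V} → U ∈ A → V ∈ A → (U ∪ V) ∈ A
      ∩-closedˡ : ∀ {U V} → U ∈ A → V ∈ A → (U ∩ V) ∈ A
      ∪-closedʳ : ∀ {U V} → U ∈ B → V ∈ B → (U ∪ V) ∈ B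
      ∩-closedʳ : ∀ {U V} → U ∈ B → V ∈ B → (U ∩ V) ∈ B
      ∪-absorbʳ : Absorbs A B
      ∩-absorbˡ : ∀ {U V} → U ∈ A → V ∈ B → (U ∩ V) ∈ A

  extend-isTopology : ∀ {A B} → IsExtensionPair A B → IsTopology (extend A B)
  extend-isTopology {A} {B} pair = record
    { distinct   = Unique.++⁺ (Unique.map⁺ ∷-injectiveʳ distinctˡ)
                              (Unique.map⁺ ∷-injectiveʳ distinctʳ) disjoint
    ; empty-open = ∈-extend⁺ˡ ⊥∈ˡ
    ; full-open  = ∈-extend⁺ʳ ⊤∈ʳ
    ; ∪-closed   = ∪-closed
    ; ∩-closed   = ∩-closed
    }
    where
    open IsExtensionPair pair

    disjoint : ∀ {W} → ¬ (W ∈ map (false ∷_) A × W ∈ map (true ∷_) B)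
    disjoint (p , q) with ∈-map⁻ (false ∷_) p | ∈-map⁻ (true ∷_) q
    ... | _ , _ , refl | _ , _ , ()

    ∪-closed : ∀ {U V} → U ∈ extend A B → V ∈ extend A B → (U ∪ V) ∈ extend A B
    ∪-closed {false ∷ U} {false ∷ V} p q = ∈-extend⁺ˡ (∪-closedˡ (∈-extend⁻ˡ p) (∈-extend⁻ˡ q))
    ∪-closed {false ∷ U} {true ∷ V}  p q = ∈-extend⁺ʳ (∪-absorbʳ (∈-extend⁻ˡ p) (∈-extend⁻ʳ q))
    ∪-closed {true ∷ U}  {false ∷ V} p q =
      ∈-extend⁺ʳ (subst (_∈ B) (∪-comm V U) (∪-absorbʳ (∈-extend⁻ˡ q) (∈-extend⁻ʳ p)))
    ∪-closed {true ∷ U}  {true ∷ V}  p q = ∈-extend⁺ʳ (∪-closedʳ (∈-extend⁻ʳ p) (∈-extend⁻ʳ q))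

    ∩-closed : ∀ {U V} → U ∈ extend A B → V ∈ extend A B → (U ∩ V) ∈ extend A B
    ∩-closed {false ∷ U} {false ∷ V} p q = ∈-extend⁺ˡ (∩-closedˡ (∈-extend⁻ˡ p) (∈-extend⁻ˡ q))
    ∩-closed {false ∷ U} {true ∷ V}  p q = ∈-extend⁺ˡ (∩-absorbˡ (∈-extend⁻ˡ p) (∈-extend⁻ʳ q))
    ∩-closed {true ∷ U}  {false ∷ V} p q =
      ∈-extend⁺ˡ (subst (_∈ A) (∩-comm V U) (∩-absorbˡ (∈-extend⁻ˡ q) (∈-extend⁻ʳ p)))
    ∩-closed {true ∷ U}  {true ∷ V}  p q = ∈-extend⁺ʳ (∩-closedʳ (∈-extend⁻ʳ p) (∈-extend⁻ʳ q))

  record IsFilter (𝒯 Φ : List (Subset n)) : Set where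
    field
      distinct : Unique Φ
      ⊤∈       : ⊤ ∈ Φ
      ⊆𝒯       : ∀ {U} → U ∈ Φ → U ∈ 𝒯
      ∩-closed : ∀ {U V} → U ∈ Φ → V ∈ Φ → (U ∩ V) ∈ Φ
      absorbs  : Absorbs 𝒯 Φ

    ∪-closed : ∀ {U V} → U ∈ Φ → V ∈ Φ → (U ∪ V) ∈ Φ
    ∪-closed p q = absorbs (⊆𝒯 p) q

    isFilter-of-itself : IsFilter Φ Φ
    isFilter-of-itself = record
      { distinct = distinct ; ⊤∈ = ⊤∈ ; ⊆𝒯 = λ p → p ; ∩-closed = ∩-closed ; absorbs = ∪-closed }

  module _ {𝒯 : List (Subset n)} (top : IsTopology 𝒯) where
    open IsTopology top

    topology-isFilter : IsFilter 𝒯 𝒯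
    topology-isFilter = record
      { distinct = distinct ; ⊤∈ = full-open ; ⊆𝒯 = λ p → p
      ; ∩-closed = ∩-closed ; absorbs = ∪-closed }

    doubling-isExtensionPair : IsExtensionPair 𝒯 𝒯
    doubling-isExtensionPair = record
      { distinctˡ = distinct ; distinctʳ = distinct ; ⊥∈ˡ = empty-open ; ⊤∈ʳ = full-open
      ; ∪-closedˡ = ∪-closed ; ∩-closedˡ = ∩-closed ; ∪-closedʳ = ∪-closed ; ∩-closedʳ = ∩-closed
      ; ∪-absorbʳ = ∪-closed ; ∩-absorbˡ = ∩-closed }

    genericPoint-isExtensionPair : IsExtensionPair [ ⊥ ] 𝒯
    genericPoint-isExtensionPair = record
      { distinctˡ = [] ∷ [] ; distinctʳ = distinct ; ⊥∈ˡ = here refl ; ⊤∈ʳ = full-open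
      ; ∪-closedˡ = ⊥-absorbs ; ∩-closedˡ = ⊥-∩-closed
      ; ∪-closedʳ = ∪-closed ; ∩-closedʳ = ∩-closed
      ; ∪-absorbʳ = ⊥-absorbs ; ∩-absorbˡ = ⊥-∩-closed }

    filter-isExtensionPair : ∀ {Φ} → IsFilter 𝒯 Φ → IsExtensionPair 𝒯 Φ
    filter-isExtensionPair filter = record
      { distinctˡ = distinct ; distinctʳ = Φ.distinct ; ⊥∈ˡ = empty-open ; ⊤∈ʳ = Φ.⊤∈
      ; ∪-closedˡ = ∪-closed ; ∩-closedˡ = ∩-closed
      ; ∪-closedʳ = Φ.∪-closed ; ∩-closedʳ = Φ.∩-closed
      ; ∪-absorbʳ = Φ.absorbs ; ∩-absorbˡ = λ p q → ∩-closed p (Φ.⊆𝒯 q) }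
      where module Φ = IsFilter filter

extend-isFilter : ∀ {n} {A B Φ : List (Subset n)} → IsFilter B Φ → Absorbs A Φ →
                  IsFilter (extend A B) (map (true ∷_) Φ)
extend-isFilter {A = A} {B} {Φ} filter A-absorbs = record
  { distinct = Unique.map⁺ ∷-injectiveʳ distinct
  ; ⊤∈       = ∈-map⁺ (true ∷_) ⊤∈
  ; ⊆𝒯       = ⊆extend
  ; ∩-closed = ∩-closed′
  ; absorbs  = absorbs′
  }
  where
  open IsFilter filter

  ⊆extend : ∀ {W} → W ∈ map (true ∷_) Φ → W ∈ extend A B
  ⊆extend p with ∈-map⁻ (true ∷_) p
  ... | _ , U∈Φ , refl = ∈-extend⁺ʳ (⊆𝒯 U∈Φ)

  ∩-closed′ : ∀ {W X} → W ∈ map (true ∷_) Φ → X ∈ map (true ∷_) Φ →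
              (W ∩ X) ∈ map (true ∷_) Φ
  ∩-closed′ p q with ∈-map⁻ (true ∷_) p | ∈-map⁻ (true ∷_) q
  ... | _ , U∈Φ , refl | _ , V∈Φ , refl = ∈-map⁺ (true ∷_) (∩-closed U∈Φ V∈Φ)

  absorbs′ : Absorbs (extend A B) (map (true ∷_) Φ)
  absorbs′ {false ∷ U} p q with ∈-map⁻ (true ∷_) q
  ... | _ , V∈Φ , refl = ∈-map⁺ (true ∷_) (A-absorbs (∈-extend⁻ˡ p) V∈Φ)
  absorbs′ {true ∷ U} p q with ∈-map⁻ (true ∷_) q
  ... | _ , V∈Φ , refl = ∈-map⁺ (true ∷_) (absorbs (∈-extend⁻ʳ p) V∈Φ)

empty-isTopology : IsTopology {0} [ [] ]
empty-isTopology = record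
  { distinct = [] ∷ [] ; empty-open = here refl ; full-open = here refl
  ; ∪-closed = λ { (here refl) (here refl) → here refl }
  ; ∩-closed = λ { (here refl) (here refl) → here refl } }

singleton-isTopology : IsTopology {1} (extend [ [] ] [ [] ])
singleton-isTopology = extend-isTopology (doubling-isExtensionPair empty-isTopology)

record FilteredTopology (n k : ℕ) : Set where
  field
    opens         : List (Subset n)
    isTopology    : IsTopology opens
    length-opens  : length opens ≡ k
    filter        : List (Subset n)
    isFilter      : IsFilter opens filter
    length-filter : length filter ≡ 3

module _ {n k : ℕ} (X : FilteredTopology n k) where
  open FilteredTopology X

  private
    length-lifted-filter : length (map (true ∷_) filter) ≡ 3
    length-lifted-filter = trans (length-map (true ∷_) filter) length-filter

  double : FilteredTopology (suc n) (k + k)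
  double = record
    { opens         = extend opens opens
    ; isTopology    = extend-isTopology (doubling-isExtensionPair isTopology)
    ; length-opens  = trans (length-extend {A = opens} {B = opens})
                            (cong₂ _+_ length-opens length-opens)
    ; filter        = map (true ∷_) filter
    ; isFilter      = extend-isFilter isFilter (IsFilter.absorbs isFilter)
    ; length-filter = length-lifted-filter
    }

  addGenericPoint : FilteredTopology (suc n) (suc k)
  addGenericPoint = record
    { opens         = extend [ ⊥ ] opens
    ; isTopology    = extend-isTopology (genericPoint-isExtensionPair isTopology)
    ; length-opens  = trans (length-extend {A = [ ⊥ ]} {B = opens}) (cong suc length-opens)
    ; filter        = map (true ∷_) filter
    ; isFilter      = extend-isFilter isFilter ⊥-absorbs
    ; length-filter = length-lifted-filter
    }

  addFilterPoint : FilteredTopology (suc n) (k + 3)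
  addFilterPoint = record
    { opens         = extend opens filter
    ; isTopology    = extend-isTopology (filter-isExtensionPair isTopology isFilter)
    ; length-opens  = trans (length-extend {A = opens} {B = filter})
                            (cong₂ _+_ length-opens length-filter)
    ; filter        = map (true ∷_) filter
    ; isFilter      = extend-isFilter (IsFilter.isFilter-of-itself isFilter)
                                      (IsFilter.absorbs isFilter)
    ; length-filter = length-lifted-filter
    }

sierpinski : FilteredTopology 2 3
sierpinski = record
  { opens         = extend [ ⊥ ] (extend [ [] ] [ [] ])
  ; isTopology    = isTopology
  ; length-opens  = refl
  ; filter        = extend [ ⊥ ] (extend [ [] ] [ [] ])
  ; isFilter      = topology-isFilter isTopology
  ; length-filter = refl
  }
  where
  isTopology = extend-isTopology (genericPoint-isExtensionPair singleton-isTopology)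

Realisable : ℕ → Set
Realisable k = ∃ λ n → 1 ≤ n × 2 * n ≤ 3 * ⌊log₂ k ⌋ + 2 × FilteredTopology n k

realised : ∀ {n k} → FilteredTopology (suc n) k →
           {True (2 * suc n ≤? 3 * ⌊log₂ k ⌋ + 2)} → Realisable k
realised {n} X {bound} = suc n , s≤s z≤n , toWitness bound , X

realisable-small : ∀ k → 3 ≤ k → k < 12 → Realisable k
realisable-small 0 () _
realisable-small 1 (s≤s ()) _
realisable-small 2 (s≤s (s≤s ())) _
realisable-small 3  _ _ = realised sierpinski
realisable-small 4  _ _ = realised (addGenericPoint sierpinski)
realisable-small 5  _ _ = realised (addGenericPoint (addGenericPoint sierpinski))
realisable-small 6  _ _ = realised (double sierpinski)
realisable-small 7  _ _ = realised (addGenericPoint (double sierpinski))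
realisable-small 8  _ _ = realised (double (addGenericPoint sierpinski))
realisable-small 9  _ _ = realised (addFilterPoint (double sierpinski))
realisable-small 10 _ _ = realised (double (addGenericPoint (addGenericPoint sierpinski)))
realisable-small 11 _ _ = realised (addFilterPoint (double (addGenericPoint sierpinski)))
realisable-small (suc (suc (suc (suc (suc (suc (suc (suc (suc (suc (suc (suc k)))))))))))) _ k<12 =
  contradiction k<12 (m+n≮m 12 k)

2*[2*q]≡q*4 : ∀ q → 2 * (2 * q) ≡ q * 4
2*[2*q]≡q*4 = solve-∀

2+⌊log₂q⌋≤⌊log₂[r+q*4]⌋ : ∀ r q → 1 ≤ q → 2 + ⌊log₂ q ⌋ ≤ ⌊log₂ (r + q * 4) ⌋
2+⌊log₂q⌋≤⌊log₂[r+q*4]⌋ r q@(suc _) _ = begin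
  2 + ⌊log₂ q ⌋           ≡⟨ cong suc (sym (⌊log₂[2*b]⌋≡1+⌊log₂b⌋ q)) ⟩
  1 + ⌊log₂ (2 * q) ⌋     ≡⟨ sym (⌊log₂[2*b]⌋≡1+⌊log₂b⌋ (2 * q)) ⟩
  ⌊log₂ (2 * (2 * q)) ⌋   ≤⟨ ⌊log₂⌋-mono-≤ (≤-trans (≤-reflexive (2*[2*q]≡q*4 q)) (m≤n+m (q * 4) r)) ⟩
  ⌊log₂ (r + q * 4) ⌋     ∎
  where open ≤-Reasoning

2*[3+n]≤3*b+2 : ∀ {n a b} → 2 * n ≤ 3 * a + 2 → 2 + a ≤ b → 2 * (3 + n) ≤ 3 * b + 2
2*[3+n]≤3*b+2 {n} {a} {b} n≤a b≥2+a = begin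
  2 * (3 + n)       ≡⟨ *-distribˡ-+ 2 3 n ⟩
  6 + 2 * n         ≤⟨ +-monoʳ-≤ 6 n≤a ⟩
  6 + (3 * a + 2)   ≡⟨ sym (+-assoc 6 (3 * a) 2) ⟩
  6 + 3 * a + 2     ≡⟨ cong (_+ 2) (sym (*-distribˡ-+ 3 2 a)) ⟩
  3 * (2 + a) + 2   ≤⟨ +-monoˡ-≤ 2 (*-monoʳ-≤ 3 b≥2+a) ⟩
  3 * b + 2         ∎
  where open ≤-Reasoning

q+q+[q+q]≡q*4 : ∀ q → (q + q) + (q + q) ≡ q * 4
q+q+[q+q]≡q*4 = solve-∀

1+q+q+[1+q+q]≡2+q*4 : ∀ q → suc (q + q) + suc (q + q) ≡ 2 + q * 4
1+q+q+[1+q+q]≡2+q*4 = solve-∀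

q+q+[q+q]+3≡3+q*4 : ∀ q → (q + q) + (q + q) + 3 ≡ 3 + q * 4
q+q+[q+q]+3≡3+q*4 = solve-∀

realisable-r+q*4 : ∀ {q} → 1 ≤ q → Realisable q → ∀ r → r < 4 → Realisable (r + q * 4)
realisable-r+q*4 {q} 1≤q (n , _ , n-bound , X) = go
  where
  bound : ∀ r → 2 * (3 + n) ≤ 3 * ⌊log₂ (r + q * 4) ⌋ + 2
  bound r = 2*[3+n]≤3*b+2 n-bound (2+⌊log₂q⌋≤⌊log₂[r+q*4]⌋ r q 1≤q)

  go : ∀ r → r < 4 → Realisable (r + q * 4)
  go 0 _ = 2 + n , s≤s z≤n , ≤-trans (*-monoʳ-≤ 2 (n≤1+n (2 + n))) (bound 0) ,
           subst (FilteredTopology (2 + n)) (q+q+[q+q]≡q*4 q) (double (double X))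
  go 1 _ = 3 + n , s≤s z≤n , bound 1 ,
           subst (FilteredTopology (3 + n)) (cong suc (q+q+[q+q]≡q*4 q))
                 (addGenericPoint (double (double X)))
  go 2 _ = 3 + n , s≤s z≤n , bound 2 ,
           subst (FilteredTopology (3 + n)) (1+q+q+[1+q+q]≡2+q*4 q)
                 (double (addGenericPoint (double X)))
  go 3 _ = 3 + n , s≤s z≤n , bound 3 ,
           subst (FilteredTopology (3 + n)) (q+q+[q+q]+3≡3+q*4 q)
                 (addFilterPoint (double (double X)))
  go (suc (suc (suc (suc r)))) r<4 = contradiction r<4 (m+n≮m 4 r)

realisable : ∀ k → 3 ≤ k → Realisable k
realisable = <-rec (λ k → 3 ≤ k → Realisable k) go
  where
  go : ∀ k → (∀ {j} → j < k → 3 ≤ j → Realisable j) → 3 ≤ k → Realisable k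
  go k rec 3≤k with k <? 12
  ... | yes k<12 = realisable-small k 3≤k k<12
  ... | no k≮12 = subst Realisable (sym (m≡m%n+[m/n]*n k 4))
                    (realisable-r+q*4 (≤-trans (s≤s z≤n) 3≤q) (rec q<k 3≤q) (k % 4) (m%n<n k 4))
    where
    12≤k : 12 ≤ k
    12≤k = ≮⇒≥ k≮12
    3≤q : 3 ≤ k / 4
    3≤q = /-monoˡ-≤ 4 12≤k
    q<k : k / 4 < k
    q<k = m/n<m k 4 {{>-nonZero (≤-trans (s≤s z≤n) 12≤k)}} (s≤s (s≤s z≤n))

proposition3p7 : (k : ℕ) → 2 ≤ k →
    ∃ λ n → 1 ≤ n × 2 * n ≤ 3 * ⌊log₂ k ⌋ + 2 × HasTopologyWithOpens n k
proposition3p7 0 ()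
proposition3p7 1 (s≤s ())
proposition3p7 2 _ = 1 , s≤s z≤n , s≤s (s≤s z≤n) , _ , singleton-isTopology , refl
proposition3p7 k@(suc (suc (suc _))) _ with realisable k (s≤s (s≤s (s≤s z≤n)))
... | n , 1≤n , bound , X = n , 1≤n , bound , opens , isTopology , length-opens
  where open FilteredTopology X
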